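{- Let $\mathcal{L}$ be a finitely nested $\lambda$-TRS. Then every term $t$ of the losim-TRS for $\mathcal{L}$ has finite $\lambda$-term depth $|t|_\lambda\in\mathbb{N}$; hence $|\cdot|_\lambda$ is a well-defined function from terms of the losim-TRS for $\mathcal{L}$ to $\mathbb{N}$.
   Context: A $\lambda$-TRS is a pair $\mathcal{L}=(\Sigma,R)$ where $\Sigma$ is a signature containing the binary application symbol $@$; the symbols in $\Sigma^-:=\Sigma\setminus\{@\}$ are called scope symbols, and $R$ contains, for each scope symbol $f$ of arity $k$, exactly one (defining) rule $@(f(x_1,\dots,x_k),y)\to F(x_1,\dots,x_k,y)$, where $F$ is a $(k+1)$-ary context over $\Sigma$, the scope context of $f$. A scope symbol $f$ depends on $g$ if $g$ occurs in the scope context of $f$; $\mathcal{L}$ is finitely nested if there is no infinite chain $f_0,f_1,f_2,\dots$ of scope symbols with each $f_m$ depending on $f_{m+1}$. Let $\Sigma_\lambda$ consist of constants $v_j$ ($j\in\mathbb{N}$), $@$, and unary named-abstraction symbols $\lambda v_j$ ($j\in\mathbb{N}$). Terms of the losim-TRS for $\mathcal{L}$ are the (finite) terms over $\Sigma\cup\Sigma_\lambda\cup\{\mathit{losim}\}\cup\{\mathit{thunk}^n_i,\mathit{unthunk}^n_i : n,i\in\mathbb{N}\}$ (disjoint from $\Sigma^-$), where $\mathit{losim}$ is unary and $\mathit{thunk}^n_i,\mathit{unthunk}^n_i$ have arity $n+1$. Expansion: add unary symbols $\mathit{exp}_i$ ($i\in\mathbb{N}$) with rules $\mathit{exp}_i(@(x_1,x_2))\to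 @(\mathit{exp}_i(x_1),\mathit{exp}_i(x_2))$; $\mathit{exp}_i(f(x_1,\dots,x_k))\to\lambda v_i(\mathit{exp}_{i+1}(F(x_1,\dots,x_k,v_i)))$ for each scope symbol $f$ with scope context $F$; $\mathit{exp}_i(v_j)\to v_j$; $\mathit{exp}_i(\lambda v_j(x))\to\lambda v_j(\mathit{exp}_{\max\{i,j\}+1}(x))$; $\mathit{exp}_i(\mathit{losim}(x))\to\mathit{exp}_i(x)$; $\mathit{exp}_i(\mathit{thunk}^0_j(x))\to\mathit{exp}_{\max\{i,j\}}(x)$; and $\mathit{exp}_i(\mathit{thunk}^{n+1}_j(x,y_1,\dots,y_{n+1}))$ and $\mathit{exp}_i(\mathit{unthunk}^{n+1}_j(x,y_1,\dots,y_{n+1}))$ both rewrite to $@(\cdots@(\mathit{exp}_{i'}(x),\mathit{exp}_{i'}(y_1))\cdots,\mathit{exp}_{i'}(y_{n+1}))$ with $i'=\max\{i,j\}$. $[\![t]\!]$ is the unique finite or infinite normal form of $\mathit{exp}_0(t)$, and $|t|_\lambda\in\mathbb{N}\cup\{\infty\}$ is the depth of $[\![t]\!]$, where term variables (and residual $\mathit{exp}_i(x)$ for a variable $x$) have depth $0$. -}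

module Defs where

open import Data.Nat using (ℕ; zero; suc; _⊔_; _≤_)
open import Data.Fin using (Fin)
open import Data.Vec using (Vec; []; _∷_; _∷ʳ_; lookup; reverse)
open import Data.Vec.Relation.Unary.Any using (Any)
open import Data.Product using (Σ; _×_)
open import Relation.Binary.PropositionalEquality using (_≡_)
open import Induction.WellFounded using (WellFounded)

data STerm (S : Set) (ar : S → ℕ) (V : Set) : Set where
  var : V → STerm S ar V
  app : STerm S ar V → STerm S ar V → STerm S ar V
  sym : (f : S) → Vec (STerm S ar V) (ar f) → STerm S ar V

-- A λ-TRS: scope symbols, their arities, and for every scope symbol f of
-- arity k its scope context F (a (k+1)-ary context over Σ, i.e. a term
-- over Σ in the variables x₁..x_k (Fin indices 0..k-1) and y (index k)).
-- The defining rule of f is  @(f(x₁,…,x_k),y) → F(x₁,…,x_k,y).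
record LamTRS : Set₁ where
  field
    S   : Set
    ar  : S → ℕ
    ctx : (f : S) → STerm S ar (Fin (suc (ar f)))
open LamTRS public

data Occurs {S : Set} {ar : S → ℕ} {V : Set} (g : S) : STerm S ar V → Set where
  here   : ∀ {xs} → Occurs g (sym g xs)
  inside : ∀ {f xs} → Any (Occurs g) xs → Occurs g (sym f xs)
  appˡ   : ∀ {a b} → Occurs g a → Occurs g (app a b)
  appʳ   : ∀ {a b} → Occurs g b → Occurs g (app a b)

DependsOn : (L : LamTRS) → S L → S L → Set
DependsOn L f g = Occurs g (ctx L f)

-- Finitely nested: no infinite chain f₀,f₁,… with fₘ depending on fₘ₊₁,
-- rendered constructively as well-foundedness of the converse of
-- "depends on".
FinitelyNested : LamTRS → Set
FinitelyNested L = WellFounded (λ g f → DependsOn L f g)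

data Term (L : LamTRS) : Set where
  var     : ℕ → Term L
  app     : Term L → Term L → Term L
  sym     : (f : S L) → Vec (Term L) (ar L f) → Term L
  v       : ℕ → Term L
  lam     : ℕ → Term L → Term L
  losim   : Term L → Term L
  thunk   : (n i : ℕ) → Term L → Vec (Term L) n → Term L
  unthunk : (n i : ℕ) → Term L → Vec (Term L) n → Term L

module _ {L : LamTRS} where
  mutual
    inst : ∀ {m} → STerm (S L) (ar L) (Fin m) → Vec (Term L) m → Term L
    inst (var x)    ts = lookup ts x
    inst (app a b)  ts = app (inst a ts) (inst b ts)
    inst (sym f xs) ts = sym f (insts xs ts)

    insts : ∀ {m k} → Vec (STerm (S L) (ar L) (Fin m)) k → Vec (Term L) m → Vec (Term L) k
    insts []       ts = []
    insts (x ∷ xs) ts = inst x ts ∷ insts xs ts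

  mutual
    tdepth : Term L → ℕ
    tdepth (var x)             = 0
    tdepth (app a b)           = suc (tdepth a ⊔ tdepth b)
    tdepth (sym f xs)          = suc (tdepths xs)
    tdepth (v j)               = 1
    tdepth (lam j t)           = suc (tdepth t)
    tdepth (losim t)           = suc (tdepth t)
    tdepth (thunk n i t ys)    = suc (tdepth t ⊔ tdepths ys)
    tdepth (unthunk n i t ys)  = suc (tdepth t ⊔ tdepths ys)

    tdepths : ∀ {k} → Vec (Term L) k → ℕ
    tdepths []       = 0
    tdepths (t ∷ ts) = tdepth t ⊔ tdepths ts

-- Truncations of the (possibly infinite) normal form ⟦t⟧ of exp₀(t).
-- Out represents a prefix of the normal form; `cut` marks a position at
-- the truncation depth whose subtree has been removed.

data Out (L : LamTRS) : Set where
  cut   : Out L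
  rvar  : ℕ → ℕ → Out L          -- residual exp_i(x), x a term variable
  stuck : ℕ → ℕ → Term L → Out L -- residual exp_i(unthunk⁰_j(s)) (no rule applies)
  ovar  : ℕ → Out L
  olam  : ℕ → Out L → Out L
  oapp  : Out L → Out L → Out L

module _ {L : LamTRS} where
  -- expT n i t : the normal form of exp_i(t), truncated so that every
  -- node at depth (level) n, counted from the root at level 0, is `cut`.
  mutual
    expT : ℕ → ℕ → Term L → Out L
    expT zero    i t                     = cut
    expT (suc n) i (var x)               = rvar i x
    expT (suc n) i (app a b)             = oapp (expT n i a) (expT n i b)
    expT (suc n) i (sym f xs)            =
      olam i (expT n (suc i) (inst (ctx L f) (xs ∷ʳ v i)))
    expT (suc n) i (v j)                 = ovar j
    expT (suc n) i (lam j t)             = olam j (expT n (suc (i ⊔ j)) t)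
    expT (suc n) i (losim t)             = expT (suc n) i t
    expT (suc n) i (thunk zero j t [])   = expT (suc n) (i ⊔ j) t
    expT (suc n) i (thunk (suc m) j t ys)   = spine (suc n) (i ⊔ j) t (reverse ys)
    expT (suc n) i (unthunk zero j t [])    = stuck i j t
    expT (suc n) i (unthunk (suc m) j t ys) = spine (suc n) (i ⊔ j) t (reverse ys)

    -- @(⋯@(exp_i(t), exp_i(y₁))⋯, exp_i(y_k)), given [y_k, …, y₁]
    spine : ∀ {k} → ℕ → ℕ → Term L → Vec (Term L) k → Out L
    spine zero    i t rys      = cut
    spine (suc n) i t []       = expT (suc n) i t
    spine (suc n) i t (y ∷ rys) = oapp (spine n i t rys) (expT n i y)

  odepth : Out L → ℕ
  odepth cut          = 0
  odepth (rvar i x)   = 0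
  odepth (stuck i j s) = suc (suc (tdepth s))   -- depth of the term exp_i(unthunk⁰_j(s))
  odepth (ovar j)     = 1
  odepth (olam j o)   = suc (odepth o)
  odepth (oapp a b)   = suc (odepth a ⊔ odepth b)

-- Since odepth (expT n 0 t) = min n (depth ⟦t⟧), this says that
-- the supremum over n of the truncated depths is attained and equals d.
LamDepthIs : (L : LamTRS) → Term L → ℕ → Set
LamDepthIs L t d =
  ((n : ℕ) → odepth (expT n 0 t) ≤ d) × Σ ℕ (λ n → odepth (expT n 0 t) ≡ d)

-- The only rule of exp that does not descend into a proper subterm of its argument is
-- the one for scope symbols, which turns f(x⃗) into λv_i(exp_{i+1}(F(x⃗,v_i))). Hence the
-- truncations expT n i t become constant in n, i.e. ⟦t⟧ is finite, by well-founded
-- induction along "depends on" (finite nesting) and, inside it, structural induction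
-- on terms and scope contexts. The truncations are prefixes of one another, so their
-- depths form a monotone, eventually constant sequence whose maximum is |t|_λ.
module Submission where

open import Defs
open import Data.Nat using (ℕ; zero; suc; _⊔_; _≤_; z≤n; s≤s)
open import Data.Nat.Properties
  using (≤-refl; ≤-trans; ≤-antisym; ≤-total; m≤m⊔n; m≤n⊔m; ⊔-mono-≤; n≤1+n)
open import Data.Fin using (Fin)
open import Data.Vec using (Vec; []; _∷_; _∷ʳ_; reverse)
open import Data.Vec.Properties using (reverse-∷)
open import Data.Vec.Relation.Unary.All using (All; []; _∷_)
open import Data.Vec.Relation.Unary.All.Properties using (lookup⁺)
open import Data.Vec.Relation.Unary.Any using (Any; here; there)
open import Data.Product using (Σ; ∃; _×_; _,_)
open import Data.Sum using (inj₁; inj₂)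
open import Function using (_∘_)
open import Relation.Binary.Core using (_Preserves_⟶_)
open import Relation.Binary.PropositionalEquality
  using (_≡_; refl; cong; cong₂; trans; subst) renaming (sym to ≡-sym)
open import Induction.WellFounded using (Acc; acc)

module _ {a p} {A : Set a} {P : A → Set p} where

  All-∷ʳ⁺ : ∀ {n} {xs : Vec A n} {y} → All P xs → P y → All P (xs ∷ʳ y)
  All-∷ʳ⁺ []         py = py ∷ []
  All-∷ʳ⁺ (px ∷ pxs) py = px ∷ All-∷ʳ⁺ pxs py

  All-reverse⁺ : ∀ {n} {xs : Vec A n} → All P xs → All P (reverse xs)
  All-reverse⁺ []               = []
  All-reverse⁺ {xs = x ∷ xs} (px ∷ pxs) =
    subst (All P) (≡-sym (reverse-∷ x xs)) (All-∷ʳ⁺ (All-reverse⁺ pxs) px)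

module _ {a} {A : Set a} where

  ConstantFrom : (ℕ → A) → ℕ → Set a
  ConstantFrom g N = ∀ m → N ≤ m → g m ≡ g N

  EventuallyConstant : (ℕ → A) → Set a
  EventuallyConstant g = ∃ (ConstantFrom g)

  constantFrom-≤ : ∀ {g N M} → N ≤ M → ConstantFrom g N → ConstantFrom g M
  constantFrom-≤ N≤M c m M≤m = trans (c m (≤-trans N≤M M≤m)) (≡-sym (c _ N≤M))

  ec-const : ∀ x → EventuallyConstant (λ _ → x)
  ec-const x = 0 , λ _ _ → refl

  ec-tail : ∀ {g} → EventuallyConstant g → EventuallyConstant (g ∘ suc)
  ec-tail (N , c) = N , λ m N≤m → constantFrom-≤ (n≤1+n N) c (suc m) (s≤s N≤m)

  ec-fromTail : ∀ {g} → EventuallyConstant (g ∘ suc) → EventuallyConstant g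
  ec-fromTail (N , c) = suc N , λ { (suc m) (s≤s N≤m) → c m N≤m }

module _ {a b} {A : Set a} {B : Set b} where

  ec-map : (f : A → B) {g : ℕ → A} →
    EventuallyConstant g → EventuallyConstant (λ m → f (g m))
  ec-map f (N , c) = N , λ m N≤m → cong f (c m N≤m)

  ec-zipWith : ∀ {c} {C : Set c} (f : A → B → C) {g : ℕ → A} {h : ℕ → B} →
    EventuallyConstant g → EventuallyConstant h →
    EventuallyConstant (λ m → f (g m) (h m))
  ec-zipWith f (N , c) (M , d) = N ⊔ M , λ m N⊔M≤m →
    cong₂ f (constantFrom-≤ (m≤m⊔n N M) c m N⊔M≤m)
            (constantFrom-≤ (m≤n⊔m N M) d m N⊔M≤m)

IsMaximum : (ℕ → ℕ) → ℕ → Set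
IsMaximum g d = (∀ n → g n ≤ d) × ∃ λ n → g n ≡ d

maximum-unique : ∀ {g d d′} → IsMaximum g d → IsMaximum g d′ → d′ ≡ d
maximum-unique (bound , n , refl) (bound′ , n′ , refl) = ≤-antisym (bound n′) (bound′ n)

monotone-eventuallyConstant⇒maximum : ∀ {g} → g Preserves _≤_ ⟶ _≤_ →
  EventuallyConstant g → ∃ (IsMaximum g)
monotone-eventuallyConstant⇒maximum {g} mono (N , c) = g N , bound , N , refl
  where
  bound : ∀ n → g n ≤ g N
  bound n with ≤-total n N
  ... | inj₁ n≤N = mono n≤N
  ... | inj₂ N≤n = subst (_≤ g N) (≡-sym (c n N≤n)) ≤-refl

module Expansion (L : LamTRS) where

  infix 4 _⊑_

  data _⊑_ : Out L → Out L → Set where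
    cut⊑   : ∀ {o} → cut ⊑ o
    rvar⊑  : ∀ {i x} → rvar i x ⊑ rvar i x
    stuck⊑ : ∀ {i j s} → stuck i j s ⊑ stuck i j s
    ovar⊑  : ∀ {j} → ovar j ⊑ ovar j
    olam⊑  : ∀ {j o o′} → o ⊑ o′ → olam j o ⊑ olam j o′
    oapp⊑  : ∀ {a b a′ b′} → a ⊑ a′ → b ⊑ b′ → oapp a b ⊑ oapp a′ b′

  odepth-mono : odepth Preserves _⊑_ ⟶ _≤_
  odepth-mono cut⊑        = z≤n
  odepth-mono rvar⊑       = ≤-refl
  odepth-mono stuck⊑      = ≤-refl
  odepth-mono ovar⊑       = ≤-refl
  odepth-mono (olam⊑ p)   = s≤s (odepth-mono p)
  odepth-mono (oapp⊑ p q) = s≤s (⊔-mono-≤ (odepth-mono p) (odepth-mono q))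

  mutual
    expT-mono : ∀ {n m} i (t : Term L) → n ≤ m → expT n i t ⊑ expT m i t
    expT-mono i t                       z≤n     = cut⊑
    expT-mono i (var x)                 (s≤s p) = rvar⊑
    expT-mono i (app a b)               (s≤s p) = oapp⊑ (expT-mono i a p) (expT-mono i b p)
    expT-mono i (sym f xs)              (s≤s p) = olam⊑ (expT-mono (suc i) _ p)
    expT-mono i (v j)                   (s≤s p) = ovar⊑
    expT-mono i (lam j t)               (s≤s p) = olam⊑ (expT-mono _ t p)
    expT-mono i (losim t)               (s≤s p) = expT-mono i t (s≤s p)
    expT-mono i (thunk zero j t [])     (s≤s p) = expT-mono (i ⊔ j) t (s≤s p)
    expT-mono i (thunk (suc k) j t ys)  (s≤s p) = spine-mono (i ⊔ j) t (reverse ys) (s≤s p)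
    expT-mono i (unthunk zero j t [])   (s≤s p) = stuck⊑
    expT-mono i (unthunk (suc k) j t ys) (s≤s p) = spine-mono (i ⊔ j) t (reverse ys) (s≤s p)

    spine-mono : ∀ {n m k} i (t : Term L) (rys : Vec (Term L) k) → n ≤ m →
      spine n i t rys ⊑ spine m i t rys
    spine-mono i t rys       z≤n     = cut⊑
    spine-mono i t []        (s≤s p) = expT-mono i t (s≤s p)
    spine-mono i t (y ∷ rys) (s≤s p) = oapp⊑ (spine-mono i t rys p) (expT-mono i y p)

  Finite : Term L → Set
  Finite t = ∀ i → EventuallyConstant (λ n → expT n i t)

  finite-spine : ∀ {k t} {rys : Vec (Term L) k} → Finite t → All Finite rys →
    ∀ i → EventuallyConstant (λ n → spine n i t rys)
  finite-spine ft []          i = ec-fromTail (ec-tail (ft i))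
  finite-spine ft (fy ∷ frys) i = ec-fromTail (ec-zipWith oapp (finite-spine ft frys i) (fy i))

  ScopeFinite : S L → Set
  ScopeFinite f = ∀ {xs} → All Finite xs → Finite (sym f xs)

  mutual
    finite-inst : ∀ {m} (C : STerm (S L) (ar L) (Fin m)) →
      (∀ g → Occurs g C → ScopeFinite g) →
      ∀ {ts} → All Finite ts → Finite (inst C ts)
    finite-inst (var x)    h fts = lookup⁺ fts x
    finite-inst (app a b)  h fts i = ec-fromTail (ec-zipWith oapp
      (finite-inst a (λ g → h g ∘ appˡ) fts i) (finite-inst b (λ g → h g ∘ appʳ) fts i))
    finite-inst (sym f xs) h fts = h f here (finite-insts xs (λ g → h g ∘ inside) fts)

    finite-insts : ∀ {m k} (Cs : Vec (STerm (S L) (ar L) (Fin m)) k) →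
      (∀ g → Any (Occurs g) Cs → ScopeFinite g) →
      ∀ {ts} → All Finite ts → All Finite (insts Cs ts)
    finite-insts []       h fts = []
    finite-insts (C ∷ Cs) h fts =
      finite-inst C (λ g → h g ∘ here) fts ∷ finite-insts Cs (λ g → h g ∘ there) fts

  finite-v : ∀ j → Finite (v j)
  finite-v j i = ec-fromTail (ec-const (ovar j))

  scopeFinite : ∀ f → Acc (λ g f → DependsOn L f g) f → ScopeFinite f
  scopeFinite f (acc rs) fxs i = ec-fromTail (ec-map (olam i)
    (finite-inst (ctx L f) (λ g → scopeFinite g ∘ rs) (All-∷ʳ⁺ fxs (finite-v i)) (suc i)))

  module _ (nested : FinitelyNested L) where
    mutual
      finite : ∀ t → Finite t
      finite (var x)                  i = ec-fromTail (ec-const (rvar i x))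
      finite (app a b)                i = ec-fromTail (ec-zipWith oapp (finite a i) (finite b i))
      finite (sym f xs)                 = scopeFinite f (nested f) (finites xs)
      finite (v j)                      = finite-v j
      finite (lam j t)                i = ec-fromTail (ec-map (olam j) (finite t _))
      finite (losim t)                i = ec-fromTail (ec-tail (finite t i))
      finite (thunk zero j t [])      i = ec-fromTail (ec-tail (finite t (i ⊔ j)))
      finite (thunk (suc k) j t ys)   i =
        ec-fromTail (ec-tail (finite-spine (finite t) (All-reverse⁺ (finites ys)) (i ⊔ j)))
      finite (unthunk zero j t [])    i = ec-fromTail (ec-const (stuck i j t))
      finite (unthunk (suc k) j t ys) i =
        ec-fromTail (ec-tail (finite-spine (finite t) (All-reverse⁺ (finites ys)) (i ⊔ j)))

      finites : ∀ {k} (xs : Vec (Term L) k) → All Finite xs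
      finites []       = []
      finites (x ∷ xs) = finite x ∷ finites xs

proposition3p4 : (L : LamTRS) → FinitelyNested L → (t : Term L) →
    Σ ℕ (λ d → LamDepthIs L t d × ((d′ : ℕ) → LamDepthIs L t d′ → d′ ≡ d))
proposition3p4 L nested t =
  let open Expansion L
      d , maximum = monotone-eventuallyConstant⇒maximum
        (odepth-mono ∘ expT-mono 0 t) (ec-map odepth (finite nested t 0))
  in d , maximum , λ _ maximum′ → maximum-unique maximum maximum′
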